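{- For all integers $n\geqslant 2$ and $s\geqslant 0$, the $s$-jet graph $\mathcal{J}_s(K_n)$ of the complete graph $K_n$ is co-chordal.
   Context: For a simple graph $G$ with vertex set $\{x_1,\dots,x_n\}$ and $s\in\mathbb{N}$, the $s$-jet graph $\mathcal{J}_s(G)$ is the simple graph with vertex set $\{x_{i,j}\mid i=1,\dots,n,\ j=0,\dots,s\}$ in which $\{x_{i,j},x_{k,l}\}$ is an edge if and only if $\{x_i,x_k\}$ is an edge of $G$ and $j+l\leqslant s$. A graph is chordal if it has no induced cycle of length four or more; a graph is co-chordal if its complement is chordal. -}

module Defs where

open import Data.Nat using (ℕ; suc; _+_; _≤_)
open import Data.Nat.DivMod using (_%_)
open import Data.Fin using (Fin; toℕ)
open import Data.Product using (_×_; _,_; Σ)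
open import Data.Sum using (_⊎_)
open import Relation.Nullary using (¬_)
open import Relation.Binary.PropositionalEquality using (_≡_; _≢_)
open import Function.Definitions using (Injective)
open import Function.Bundles using (_⇔_)

record Graph (V : Set) : Set₁ where
  field
    Adj   : V → V → Set
    sym   : ∀ {u v} → Adj u v → Adj v u
    irrefl : ∀ {v} → ¬ Adj v v
open Graph public

K : (n : ℕ) → Graph (Fin n)
K n = record { Adj = λ i j → i ≢ j
             ; sym = λ p q → p (Relation.Binary.PropositionalEquality.sym q)
             ; irrefl = λ p → p Relation.Binary.PropositionalEquality.refl }

-- s-jet graph: vertex x_{i,j} is the pair (i , j) with j ∈ {0..s}.
-- {x_{i,j}, x_{k,l}} is an edge iff {x_i,x_k} ∈ E(G) and j + l ≤ s.
Jet : {V : Set} → (s : ℕ) → Graph V → Graph (V × Fin (suc s))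
Jet {V} s G = record
  { Adj = λ { (i , j) (k , l) → Adj G i k × (toℕ j + toℕ l ≤ s) }
  ; sym = λ { {i , j} {k , l} (a , le) →
        Graph.sym G a , Relation.Binary.PropositionalEquality.subst (_≤ s) (Data.Nat.Properties.+-comm (toℕ j) (toℕ l)) le }
  ; irrefl = λ { (a , _) → Graph.irrefl G a }
  }
  where import Data.Nat.Properties

Complement : {V : Set} → Graph V → Graph V
Complement G = record
  { Adj = λ u v → (u ≢ v) × ¬ Adj G u v
  ; sym = λ { (ne , na) → (λ e → ne (Relation.Binary.PropositionalEquality.sym e)) , (λ a → na (Graph.sym G a)) }
  ; irrefl = λ { (ne , _) → ne Relation.Binary.PropositionalEquality.refl }
  }

CycAdj : (m : ℕ) → Fin m → Fin m → Set
CycAdj m a b = (toℕ b ≡ suc (toℕ a) % suc m') ⊎ (toℕ a ≡ suc (toℕ b) % suc m')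
  where
  m' : ℕ
  m' = Data.Nat._∸_ m 1
  import Data.Nat

InducedCycle : {V : Set} → Graph V → (m : ℕ) → Set
InducedCycle {V} G m = Σ (Fin m → V) λ c →
  Injective _≡_ _≡_ c × (∀ a b → Adj G (c a) (c b) ⇔ CycAdj m a b)

Chordal : {V : Set} → Graph V → Set
Chordal G = ∀ m → 4 ≤ m → ¬ InducedCycle G m

CoChordal : {V : Set} → Graph V → Set
CoChordal G = Chordal (Complement G)

{-# OPTIONS --safe #-}
module Submission where

-- In the complement H of J_s(K_n), two vertices in the same column
-- x_{i,·} are always adjacent, and vertices in different columns are adjacent
-- exactly when their levels sum to more than s. Take a vertex a of maximal level
-- on an induced cycle of length at least four and the next three cycle vertices
-- p₁, p₂, p₃. As a is not adjacent to p₂, neither p₁ nor p₃ can reach p₂ through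
-- a large level sum, so p₁, p₂, p₃ lie in one column; then p₁p₃ is a chord.

open import Defs hiding (sym)
open import Data.Nat using (ℕ; zero; suc; _+_; _*_; _≤_; _<_; z≤n; s≤s; NonZero; >-nonZero)
open import Data.Nat.Properties
  using (≤-trans; +-comm; +-cancelʳ-≡; +-monoˡ-≤; <-≤-trans; <⇒≤; <⇒≱; ≰⇒>)
open import Data.Nat.DivMod
  using (_%_; _/_; %-distribˡ-+; m%n%n≡m%n; m%n<n; m<n⇒m%n≡m; m≡m%n+[m/n]*n)
open import Data.Nat.Divisibility using (divides; ∣⇒≤)
open import Data.Fin using (Fin; toℕ; fromℕ<; _≟_) renaming (zero to fzero)
open import Data.Fin.Properties using (toℕ-fromℕ<; toℕ<n; toℕ-injective)
open import Data.List using (allFin)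
open import Data.List.Extrema.Nat using (argmax; f[xs]≤f[argmax])
open import Data.List.Membership.Propositional.Properties using (∈-allFin)
open import Data.List.Relation.Unary.All as All using ()
open import Data.Product using (_×_; _,_; proj₁)
open import Data.Sum using (inj₁; inj₂)
open import Function.Bundles using (_⇔_; Equivalence)
open import Function.Definitions using (Injective)
open import Relation.Nullary using (¬_)
open import Relation.Nullary.Decidable using (decidable-stable)
open import Relation.Binary.PropositionalEquality
  using (_≡_; _≢_; sym; trans; cong; subst; module ≡-Reasoning)

[1+m%n]%n≡[1+m]%n : ∀ m n .{{_ : NonZero n}} → suc (m % n) % n ≡ suc m % n
[1+m%n]%n≡[1+m]%n m n = begin
  (1 + m % n) % n           ≡⟨ %-distribˡ-+ 1 (m % n) n ⟩
  (1 % n + m % n % n) % n   ≡⟨ cong (λ x → (1 % n + x) % n) (m%n%n≡m%n m n) ⟩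
  (1 % n + m % n) % n       ≡⟨ %-distribˡ-+ 1 m n ⟨
  (1 + m) % n               ∎
  where open ≡-Reasoning

[k+r]%d≢r : ∀ {k r d} .{{_ : NonZero d}} → 0 < k → k < d → (k + r) % d ≢ r
[k+r]%d≢r {k} {r} {d} 0<k k<d eq =
  <⇒≱ k<d (∣⇒≤ {{>-nonZero 0<k}} (divides ((k + r) / d) k≡q*d))
  where
  open ≡-Reasoning
  k≡q*d : k ≡ (k + r) / d * d
  k≡q*d = +-cancelʳ-≡ r k _ (begin
    k + r                          ≡⟨ m≡m%n+[m/n]*n (k + r) d ⟩
    (k + r) % d + (k + r) / d * d  ≡⟨ cong (_+ (k + r) / d * d) eq ⟩
    r + (k + r) / d * d            ≡⟨ +-comm r _ ⟩
    (k + r) / d * d + r            ∎)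

-- Cycles are taken of length suc m, so that the modulus suc (m ∸ 1) of CycAdj is suc m.
module _ {m : ℕ} where

  next : Fin (suc m) → Fin (suc m)
  next a = fromℕ< (m%n<n (suc (toℕ a)) (suc m))

  toℕ-next : ∀ a → toℕ (next a) ≡ suc (toℕ a) % suc m
  toℕ-next a = toℕ-fromℕ< _

  advance : ℕ → Fin (suc m) → Fin (suc m)
  advance zero    a = a
  advance (suc k) a = next (advance k a)

  toℕ-advance : ∀ k a → toℕ (advance k a) ≡ (k + toℕ a) % suc m
  toℕ-advance zero    a = sym (m<n⇒m%n≡m (toℕ<n a))
  toℕ-advance (suc k) a = begin
    toℕ (next (advance k a))        ≡⟨ toℕ-next (advance k a) ⟩
    suc (toℕ (advance k a)) % suc m ≡⟨ cong (λ x → suc x % suc m) (toℕ-advance k a) ⟩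
    suc ((k + toℕ a) % suc m) % suc m ≡⟨ [1+m%n]%n≡[1+m]%n (k + toℕ a) (suc m) ⟩
    suc (k + toℕ a) % suc m         ∎
    where open ≡-Reasoning

  advance-≢ : ∀ {k} → 0 < k → k ≤ m → ∀ a → advance k a ≢ a
  advance-≢ {k} 0<k k≤m a eq =
    [k+r]%d≢r 0<k (s≤s k≤m) (trans (sym (toℕ-advance k a)) (cong toℕ eq))

  CycAdj-next : ∀ a → CycAdj (suc m) a (next a)
  CycAdj-next a = inj₁ (toℕ-next a)

  ¬CycAdj-next² : 3 ≤ m → ∀ a → ¬ CycAdj (suc m) a (next (next a))
  -- The two cases say next (next a) ≡ next a and a ≡ advance 3 a.
  ¬CycAdj-next² 3≤m a (inj₁ eq) =
    advance-≢ {1} (s≤s z≤n) (≤-trans (s≤s z≤n) 3≤m) (next a)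
      (toℕ-injective (trans eq (sym (toℕ-next a))))
  ¬CycAdj-next² 3≤m a (inj₂ eq) =
    advance-≢ (s≤s z≤n) 3≤m a
      (toℕ-injective (sym (trans eq (sym (toℕ-next (next (next a)))))))

module InducedCycleProperties {V : Set} {G : Graph V} {m : ℕ} (c : Fin (suc m) → V)
  (c-injective : Injective _≡_ _≡_ c)
  (c-induced : ∀ a b → Adj G (c a) (c b) ⇔ CycAdj (suc m) a b) where

  Adj-next : ∀ a → Adj G (c a) (c (next a))
  Adj-next a = Equivalence.from (c-induced a (next a)) (CycAdj-next a)

  ¬Adj-next² : 3 ≤ m → ∀ a → ¬ Adj G (c a) (c (next (next a)))
  ¬Adj-next² 3≤m a adj = ¬CycAdj-next² 3≤m a (Equivalence.to (c-induced a _) adj)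

  ≢-next² : 2 ≤ m → ∀ a → c a ≢ c (next (next a))
  ≢-next² 2≤m a eq = advance-≢ (s≤s z≤n) 2≤m a (sym (c-injective eq))

level : ∀ {V : Set} {s} → V × Fin (suc s) → ℕ
level (_ , j) = toℕ j

module _ {V : Set} {G : Graph V} {s : ℕ} where

  sameColumn⇒Adj : ∀ {u v} → u ≢ v → proj₁ u ≡ proj₁ v → Adj (Complement (Jet s G)) u v
  sameColumn⇒Adj {u} u≢v same =
    u≢v , λ (adj , _) → Graph.irrefl G (subst (Adj G (proj₁ u)) (sym same) adj)

  s<levels⇒Adj : ∀ {u v} → u ≢ v → s < level u + level v → Adj (Complement (Jet s G)) u v
  s<levels⇒Adj u≢v high = u≢v , λ (_ , low) → <⇒≱ high low

module _ {n s : ℕ} where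

  Adj∧column≢⇒s<levels : ∀ {u v} → Adj (Complement (Jet s (K n))) u v →
                         proj₁ u ≢ proj₁ v → s < level u + level v
  Adj∧column≢⇒s<levels (_ , ¬jet) differ = ≰⇒> (λ low → ¬jet (differ , low))

  Adj-below-nonneighbour⇒sameColumn :
    ∀ {x y z} → Adj (Complement (Jet s (K n))) y z →
    x ≢ z → ¬ Adj (Complement (Jet s (K n))) x z → level y ≤ level x →
    proj₁ y ≡ proj₁ z
  Adj-below-nonneighbour⇒sameColumn {x} {y} {z} yz x≢z ¬xz y≤x =
    decidable-stable (proj₁ y ≟ proj₁ z) λ differ →
      ¬xz (s<levels⇒Adj {G = K n} x≢z
        (<-≤-trans (Adj∧column≢⇒s<levels yz differ) (+-monoˡ-≤ (level z) y≤x)))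

proposition1 : (n s : ℕ) → 2 ≤ n → CoChordal (Jet s (K n))
proposition1 n s _ (suc m) (s≤s 3≤m) (c , c-injective , c-induced) =
  ¬Adj-next² 3≤m p₁ (sameColumn⇒Adj {G = K n} (≢-next² 2≤m p₁) (trans column₁ (sym column₃)))
  where
  open InducedCycleProperties {G = Complement (Jet s (K n))} c c-injective c-induced

  2≤m : 2 ≤ m
  2≤m = <⇒≤ 3≤m

  top : Fin (suc m)
  top = argmax (λ a → level (c a)) fzero (allFin (suc m))

  top-maximal : ∀ a → level (c a) ≤ level (c top)
  top-maximal a =
    All.lookup (f[xs]≤f[argmax] {f = λ a → level (c a)} fzero (allFin (suc m))) (∈-allFin a)

  p₁ p₂ : Fin (suc m)
  p₁ = next top
  p₂ = next p₁

  column≡column₂ : ∀ {p} → Adj (Complement (Jet s (K n))) (c p) (c p₂) →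
                  proj₁ (c p) ≡ proj₁ (c p₂)
  column≡column₂ {p} adj = Adj-below-nonneighbour⇒sameColumn adj
    (≢-next² 2≤m top) (¬Adj-next² 3≤m top) (top-maximal p)

  column₁ : proj₁ (c p₁) ≡ proj₁ (c p₂)
  column₁ = column≡column₂ (Adj-next p₁)

  column₃ : proj₁ (c (next p₂)) ≡ proj₁ (c p₂)
  column₃ = column≡column₂ (Graph.sym (Complement (Jet s (K n))) (Adj-next p₂))
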